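{- Let $G$ be a strongly connected ribbon digraph. Two unicycles $(\mathbf{1}_{v_1},\varrho_1)$ and $(\mathbf{1}_{v_2},\varrho_2)$ on $G$ lie in the same rotor-router orbit if and only if $(\mathbf{1}_{v_1},\varrho_1)\sim(\mathbf{1}_{v_2},\varrho_2)$.
   Context: A digraph here is strongly connected, may have multiple edges, and has no loops. A ribbon digraph is a digraph with, for each vertex $v$, a fixed cyclic ordering of the edges leaving $v$; $e^+$ denotes the edge after $e$. A divisor is $x\in\mathbb{Z}^{V(G)}$. A rotor configuration $\varrho$ assigns to each vertex $v$ an edge $\varrho(v)$ with tail $v$; its rotor subgraph has edge set $\{\varrho(v)\}$. A divisor-and-rotor configuration (DRC) is a pair $(x,\varrho)$. Routing at $v$ transforms $(x,\varrho)$ into $(x',\varrho')$ with $\varrho'(v)=\varrho(v)^+$, $\varrho'(u)=\varrho(u)$ for $u\ne v$, and $x'=x-\mathbf{1}_v+\mathbf{1}_{v'}$ where $v'$ is the head of $\varrho(v)^+$. It is legal if $x(v)>0$, and unconstrained otherwise (no condition). A one chip-and-rotor configuration is a DRC $(\mathbf{1}_v,\varrho)$; from it the only legal routing is at $v$, giving again a one chip-and-rotor configuration (the classical rotor-routing process). The (rotor-router) orbit of a one chip-and-rotor configuration is the set of configurations reachable from it by legal games. A unicycle is a one chip-and-rotor configuration $(\mathbf{1}_v,\varrho)$ whose rotor subgraph contains a unique directed cycle, with $v$ on that cycle. Two DRCs are linearly equivalent, $(x_1,\varrho_1)\sim(x_2,\varrho_2)$, if $(x_2,\varrho_2)$ can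 be reached from $(x_1,\varrho_1)$ by a sequence of unconstrained routings. -}

module Defs where

open import Data.Nat using (ℕ; zero; suc; _≥_)
open import Data.Integer using (ℤ; +_; _+_; _-_; _<_)
open import Data.Fin using (Fin; _≟_)
open import Data.Fin.Subset using (Subset; _∈_; Nonempty)
open import Data.Vec using (Vec; lookup; tabulate; updateAt; _[_]≔_)
open import Data.Product using (Σ; ∃; ∃-syntax; _×_; _,_)
open import Relation.Binary.PropositionalEquality using (_≡_; _≢_)
open import Relation.Binary.Construct.Closure.ReflexiveTransitive using (Star)
open import Relation.Nullary using (yes; no)

iter : {A : Set} → (A → A) → ℕ → A → A
iter f zero    a = a
iter f (suc k) a = f (iter f k a)

-- A ribbon digraph: vertices Fin n, edges Fin m (multi-edges allowed),
-- no loops, and a cyclic successor e ↦ e⁺ on the out-edges of each vertex: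
-- next preserves the tail, and from any out-edge of v every out-edge of v is
-- reached by iterating next (so next restricted to out(v) is a single cycle).
record RibbonDigraph : Set where
  field
    n m      : ℕ
    tail     : Fin m → Fin n
    head     : Fin m → Fin n
    noLoops  : ∀ e → tail e ≢ head e
    next     : Fin m → Fin m
    next-tail : ∀ e → tail (next e) ≡ tail e
    next-cyclic : ∀ e e' → tail e ≡ tail e' → ∃[ k ] iter next k e ≡ e'

module _ (G : RibbonDigraph) where
  open RibbonDigraph G

  Arc : Fin n → Fin n → Set
  Arc a b = ∃[ e ] (tail e ≡ a × head e ≡ b)

  StronglyConnected : Set
  StronglyConnected = ∀ u w → Star Arc u w

  Divisor : Set
  Divisor = Vec ℤ n

  RotorVec : Set
  RotorVec = Vec (Fin m) n

  IsRotor : RotorVec → Set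
  IsRotor ϱ = ∀ v → tail (lookup ϱ v) ≡ v

  DRC : Set
  DRC = Divisor × RotorVec

  𝟙 : Fin n → Divisor
  𝟙 v = tabulate (λ u → indicator u)
    where
    indicator : Fin n → ℤ
    indicator u with u ≟ v
    ... | yes _ = + 1
    ... | no  _ = + 0

  route : Fin n → DRC → DRC
  route v (x , ϱ) =
    let e  = next (lookup ϱ v)
        x₁ = updateAt x v (λ a → a - + 1)
    in updateAt x₁ (head e) (λ a → a + + 1) , ϱ [ v ]≔ e

  Step : DRC → DRC → Set
  Step c c' = ∃[ v ] (c' ≡ route v c)

  LegalStep : DRC → DRC → Set
  LegalStep (x , ϱ) c' = ∃[ v ] ((+ 0 < lookup x v) × (c' ≡ route v (x , ϱ)))

  -- linear equivalence: reachable by a sequence of unconstrained routings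
  _∼_ : DRC → DRC → Set
  _∼_ = Star Step

  InOrbit : DRC → DRC → Set
  InOrbit c c' = Star LegalStep c c'

  -- the rotor subgraph viewed as the map u ↦ head (ϱ u)
  rstep : RotorVec → Fin n → Fin n
  rstep ϱ u = head (lookup ϱ u)

  -- S is the vertex set of a directed cycle of the rotor subgraph
  -- (out-degree is 1 there, so the cycle's edges are {ϱ(u) : u ∈ S})
  IsRotorCycle : RotorVec → Subset n → Set
  IsRotorCycle ϱ S =
    Nonempty S
    × (∀ u → u ∈ S → rstep ϱ u ∈ S)
    × (∀ u w → u ∈ S → w ∈ S → ∃[ k ] iter (rstep ϱ) k u ≡ w)

  Unicycle : Fin n → RotorVec → Set
  Unicycle v ϱ =
    IsRotor ϱ
    × ∃[ S ] (IsRotorCycle ϱ S × v ∈ S × (∀ S' → IsRotorCycle ϱ S' → S' ≡ S))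

module Submission where

-- A legal game is in particular an unconstrained one, which
-- gives "⇒".  For "⇐" we record an unconstrained game as the list s of
-- vertices it routes and show, by induction on the length of s, that every
-- game taking a one-chip configuration (1_w , ϱ) to a unicycle (1_v , ϱ')
-- can be made legal:
--   * routings commute, so if w occurs in s we may route at w first; that
--     routing is legal, leaves a single chip, and the rest of s is shorter;
--   * if w does not occur in s (and s ≠ []), the chips at w never decrease,
--     so w = v; then no vertex outside s can ever gain a chip, so the final
--     rotor of each vertex of s points into s.  The rotor subgraph then has
--     a cycle inside s, which must be the unique cycle, through v = w ∉ s.

open import Defs
open import Data.Fin using (Fin)
open import Data.Product using (_,_)
open import Function.Bundles using (_⇔_)

open import Data.Nat as ℕ using (ℕ; zero; suc; z≤n; s≤s)
import Data.Nat.Properties as ℕP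
open import Data.Integer using (ℤ; +_; -_; _+_; _≤_; _<_; +≤+; +<+)
import Data.Integer.Properties as ℤP
open import Data.Integer.Tactic.RingSolver using (solve-∀)
open import Data.Fin using (toℕ; fromℕ<; _≟_)
import Data.Fin.Properties as FinP
open import Data.Fin.Subset using (Subset) renaming (_∈_ to _∈ₛ_)
open import Data.Vec using (Vec; lookup; tabulate; updateAt; _[_]≔_)
open import Data.Vec.Properties
  using (lookup∘tabulate; tabulate∘lookup; tabulate-cong; lookup∘updateAt; lookup∘updateAt′;
         lookup∘update; lookup∘update′; []≔-commutes; []=⇒lookup; lookup⇒[]=)
open import Data.List using (List; []; _∷_; length)
open import Data.List.Properties using (length-removeAt′)
open import Data.List.Relation.Unary.Any using (here; there; index)
open import Data.List.Membership.Propositional using (_∈_; _∉_; _─_)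
open import Data.Product using (∃-syntax; ∃₂; _×_; proj₁; proj₂)
open import Data.Sum using (_⊎_; inj₁; inj₂)
open import Data.Empty using (⊥; ⊥-elim)
open import Relation.Nullary using (Dec; yes; no; does)
open import Relation.Nullary.Decidable using (dec-true)
open import Relation.Binary.PropositionalEquality
open import Relation.Binary.Construct.Closure.ReflexiveTransitive as Star using (ε; _◅_)
open import Function using (_∋_)
open import Function.Bundles using (mk⇔)

iter-+ : {A : Set} (f : A → A) (a b : ℕ) (y : A) → iter f (a ℕ.+ b) y ≡ iter f a (iter f b y)
iter-+ f zero    b y = refl
iter-+ f (suc a) b y = cong f (iter-+ f a b y)

vec-ext : {A : Set} {k : ℕ} {xs ys : Vec A k} → (∀ i → lookup xs i ≡ lookup ys i) → xs ≡ ys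
vec-ext {xs = xs} {ys} eq = trans (sym (tabulate∘lookup xs)) (trans (tabulate-cong eq) (tabulate∘lookup ys))

subsetOf : {k : ℕ} {P : Fin k → Set} → (∀ y → Dec (P y)) → Subset k
subsetOf P? = tabulate (λ y → does (P? y))

∈-subsetOf⁺ : {k : ℕ} {P : Fin k → Set} (P? : ∀ y → Dec (P y)) {y : Fin k} → P y → y ∈ₛ subsetOf P?
∈-subsetOf⁺ P? {y} py = lookup⇒[]= y _ (trans (lookup∘tabulate _ y) (dec-true (P? y) py))

∈-subsetOf⁻ : {k : ℕ} {P : Fin k → Set} (P? : ∀ y → Dec (P y)) {y : Fin k} → y ∈ₛ subsetOf P? → P y
∈-subsetOf⁻ P? {y} y∈ with P? y | trans (sym (lookup∘tabulate _ y)) ([]=⇒lookup y∈)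
... | yes py | _  = py
... | no  _  | ()

-- Rearranging five summands, used to compare two orders of two routings.
swap-summands : ∀ x a b c d → x + a + b + c + d ≡ x + c + d + a + b
swap-summands = solve-∀

module Rotor (G : RibbonDigraph) where
  open RibbonDigraph G
  open import Data.List.Membership.DecPropositional (_≟_ {n}) using (_∈?_)

  δ : Fin n → ℤ → Fin n → ℤ
  δ i d z with z ≟ i
  ... | yes _ = d
  ... | no  _ = + 0

  δ-here : ∀ i d → δ i d i ≡ d
  δ-here i d with i ≟ i
  ... | yes _   = refl
  ... | no  i≢i = ⊥-elim (i≢i refl)

  δ-elsewhere : ∀ i d z → z ≢ i → δ i d z ≡ + 0
  δ-elsewhere i d z z≢i with z ≟ i
  ... | yes z≡i = ⊥-elim (z≢i z≡i)
  ... | no  _   = refl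

  δ-support : ∀ i d z → + 0 < δ i d z → z ≡ i
  δ-support i d z _ with z ≟ i
  δ-support i d z _         | yes z≡i = z≡i
  δ-support i d z (+<+ ())  | no  _

  δ-nonneg : ∀ i z → + 0 ≤ δ i (+ 1) z
  δ-nonneg i z with z ≟ i
  ... | yes _ = +≤+ z≤n
  ... | no  _ = +≤+ z≤n

  δ-cancel : ∀ i z → δ i (+ 1) z + δ i (- + 1) z ≡ + 0
  δ-cancel i z with z ≟ i
  ... | yes _ = refl
  ... | no  _ = refl

  𝟙-lookup : ∀ w z → lookup (𝟙 G w) z ≡ δ w (+ 1) z
  𝟙-lookup w z rewrite (lookup (𝟙 G w) z ≡ _ ∋ lookup∘tabulate _ z) with z ≟ w
  ... | yes _ = refl
  ... | no  _ = refl

  𝟙-positive : ∀ w → + 0 < lookup (𝟙 G w) w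
  𝟙-positive w = subst (+ 0 <_) (sym (trans (𝟙-lookup w w) (δ-here w _))) (+<+ (s≤s z≤n))

  lookup-add : ∀ (x : Divisor G) i d z → lookup (updateAt x i (_+ d)) z ≡ lookup x z + δ i d z
  lookup-add x i d z with z ≟ i
  ... | yes refl = lookup∘updateAt z x
  ... | no  z≢i  = trans (lookup∘updateAt′ z i z≢i x) (sym (ℤP.+-identityʳ _))

  chips : DRC G → Fin n → ℤ
  chips c z = lookup (proj₁ c) z

  dest : RotorVec G → Fin n → Fin n
  dest ϱ v = head (next (lookup ϱ v))

  chips-route : ∀ v (x : Divisor G) ϱ z →
    chips (route G v (x , ϱ)) z ≡ lookup x z + δ v (- + 1) z + δ (dest ϱ v) (+ 1) z
  chips-route v x ϱ z =
    trans (lookup-add (updateAt x v (λ a → a + - + 1)) (dest ϱ v) (+ 1) z)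
          (cong (_+ δ (dest ϱ v) (+ 1) z) (lookup-add x v (- + 1) z))

  chips-route-elsewhere : ∀ v (x : Divisor G) ϱ z → z ≢ v →
    chips (route G v (x , ϱ)) z ≡ lookup x z + δ (dest ϱ v) (+ 1) z
  chips-route-elsewhere v x ϱ z z≢v =
    trans (chips-route v x ϱ z)
          (cong (λ t → t + δ (dest ϱ v) (+ 1) z)
                (trans (cong (λ t → lookup x z + t) (δ-elsewhere v _ z z≢v)) (ℤP.+-identityʳ (lookup x z))))

  route-𝟙 : ∀ w ϱ → route G w (𝟙 G w , ϱ) ≡ (𝟙 G (dest ϱ w) , ϱ [ w ]≔ next (lookup ϱ w))
  route-𝟙 w ϱ = cong (_, ϱ [ w ]≔ next (lookup ϱ w)) (vec-ext moved)
    where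
    open ≡-Reasoning
    moved : ∀ z → chips (route G w (𝟙 G w , ϱ)) z ≡ lookup (𝟙 G (dest ϱ w)) z
    moved z = begin
      chips (route G w (𝟙 G w , ϱ)) z
        ≡⟨ chips-route w (𝟙 G w) ϱ z ⟩
      lookup (𝟙 G w) z + δ w (- + 1) z + δ (dest ϱ w) (+ 1) z
        ≡⟨ cong (λ t → t + δ w (- + 1) z + δ (dest ϱ w) (+ 1) z) (𝟙-lookup w z) ⟩
      δ w (+ 1) z + δ w (- + 1) z + δ (dest ϱ w) (+ 1) z
        ≡⟨ cong (_+ δ (dest ϱ w) (+ 1) z) (δ-cancel w z) ⟩
      + 0 + δ (dest ϱ w) (+ 1) z
        ≡⟨ ℤP.+-identityˡ _ ⟩
      δ (dest ϱ w) (+ 1) z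
        ≡⟨ sym (𝟙-lookup (dest ϱ w) z) ⟩
      lookup (𝟙 G (dest ϱ w)) z ∎

  two-routings : ∀ a b → a ≢ b → ∀ (x : Divisor G) ϱ z →
    chips (route G a (route G b (x , ϱ))) z
      ≡ lookup x z + δ b (- + 1) z + δ (dest ϱ b) (+ 1) z + δ a (- + 1) z + δ (dest ϱ a) (+ 1) z
  two-routings a b a≢b x ϱ z =
    trans (chips-route a (proj₁ (route G b (x , ϱ))) (proj₂ (route G b (x , ϱ))) z)
          (cong₂ (λ t e → t + δ a (- + 1) z + δ (head (next e)) (+ 1) z)
                 (chips-route b x ϱ z) (lookup∘update′ a≢b ϱ _))

  route-comm : ∀ u v (c : DRC G) → route G u (route G v c) ≡ route G v (route G u c)
  route-comm u v (x , ϱ) with u ≟ v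
  ... | yes refl = refl
  ... | no  u≢v  = cong₂ _,_ (vec-ext chips-eq) rotors-eq
    where
    v≢u : v ≢ u
    v≢u v≡u = u≢v (sym v≡u)
    chips-eq : ∀ z → chips (route G u (route G v (x , ϱ))) z ≡ chips (route G v (route G u (x , ϱ))) z
    chips-eq z = trans (two-routings u v u≢v x ϱ z)
                       (trans (swap-summands (lookup x z) (δ v (- + 1) z) (δ (dest ϱ v) (+ 1) z)
                                                     (δ u (- + 1) z) (δ (dest ϱ u) (+ 1) z))
                              (sym (two-routings v u v≢u x ϱ z)))
    rotors-eq : proj₂ (route G u (route G v (x , ϱ))) ≡ proj₂ (route G v (route G u (x , ϱ)))
    rotors-eq rewrite lookup∘update′ u≢v ϱ (next (lookup ϱ v))
                    | lookup∘update′ v≢u ϱ (next (lookup ϱ u)) = []≔-commutes ϱ v u v≢u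

  run : List (Fin n) → DRC G → DRC G
  run []      c = c
  run (v ∷ s) c = run s (route G v c)

  run-─ : ∀ {w} s (w∈s : w ∈ s) c → run s c ≡ run (s ─ w∈s) (route G w c)
  run-─ (v ∷ s) (here refl) c = refl
  run-─ {w} (v ∷ s) (there w∈s) c =
    trans (run-─ s w∈s (route G v c)) (cong (run (s ─ w∈s)) (route-comm w v c))

  steps⇒run : ∀ {c c'} → _∼_ G c c' → ∃[ s ] run s c ≡ c'
  steps⇒run ε = [] , refl
  steps⇒run ((v , refl) ◅ steps) with steps⇒run steps
  ... | s , reached = v ∷ s , reached

  Receives : List (Fin n) → DRC G → Fin n → Set
  Receives []      c z = ⊥
  Receives (v ∷ s) c z = dest (proj₂ c) v ≡ z ⊎ Receives s (route G v c) z

  route-≤ : ∀ v (x : Divisor G) ϱ z → z ≢ v → lookup x z ≤ chips (route G v (x , ϱ)) z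
  route-≤ v x ϱ z z≢v =
    subst (lookup x z ≤_) (sym (chips-route-elsewhere v x ϱ z z≢v))
      (subst (_≤ lookup x z + δ (dest ϱ v) (+ 1) z) (ℤP.+-identityʳ (lookup x z))
        (ℤP.+-monoʳ-≤ (lookup x z) (δ-nonneg (dest ϱ v) z)))

  route-< : ∀ v (x : Divisor G) ϱ z → z ≢ v → dest ϱ v ≡ z → lookup x z < chips (route G v (x , ϱ)) z
  route-< v x ϱ z z≢v refl rewrite chips-route-elsewhere v x ϱ z z≢v | δ-here z (+ 1) =
    subst (_< lookup x z + + 1) (ℤP.+-identityʳ (lookup x z)) (ℤP.+-monoʳ-< (lookup x z) (+<+ (s≤s z≤n)))

  unrouted-≤ : ∀ s c z → z ∉ s → chips c z ≤ chips (run s c) z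
  unrouted-≤ []      c       z z∉s = ℤP.≤-refl
  unrouted-≤ (v ∷ s) (x , ϱ) z z∉s =
    ℤP.≤-trans (route-≤ v x ϱ z (λ z≡v → z∉s (here z≡v)))
               (unrouted-≤ s (route G v (x , ϱ)) z (λ z∈s → z∉s (there z∈s)))

  unrouted-< : ∀ s c z → z ∉ s → Receives s c z → chips c z < chips (run s c) z
  unrouted-< (v ∷ s) (x , ϱ) z z∉s (inj₁ dest≡z) =
    ℤP.<-≤-trans (route-< v x ϱ z (λ z≡v → z∉s (here z≡v)) dest≡z)
                 (unrouted-≤ s (route G v (x , ϱ)) z (λ z∈s → z∉s (there z∈s)))
  unrouted-< (v ∷ s) (x , ϱ) z z∉s (inj₂ later) =
    ℤP.≤-<-trans (route-≤ v x ϱ z (λ z≡v → z∉s (here z≡v)))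
                 (unrouted-< s (route G v (x , ϱ)) z (λ z∈s → z∉s (there z∈s)) later)

  unrouted-rotor : ∀ s c u → u ∉ s → lookup (proj₂ (run s c)) u ≡ lookup (proj₂ c) u
  unrouted-rotor []      c       u u∉s = refl
  unrouted-rotor (v ∷ s) (x , ϱ) u u∉s =
    trans (unrouted-rotor s _ u (λ u∈s → u∉s (there u∈s))) (lookup∘update′ (λ u≡v → u∉s (here u≡v)) ϱ _)

  -- The final rotor of a routed vertex u was set by its last routing, which
  -- sent a chip along it: the head of that rotor received a chip.
  routed-rotor-receives : ∀ s c u → u ∈ s → Receives s c (head (lookup (proj₂ (run s c)) u))
  routed-rotor-receives (v ∷ s) c u u∈vs with u ∈? s
  ... | yes u∈s = inj₂ (routed-rotor-receives s (route G v c) u u∈s)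
  routed-rotor-receives (v ∷ s) (x , ϱ) u (here refl) | no u∉s =
    inj₁ (sym (cong head (trans (unrouted-rotor s _ u u∉s) (lookup∘update u ϱ _))))
  routed-rotor-receives (v ∷ s) c u (there u∈s) | no u∉s = ⊥-elim (u∉s u∈s)

  eventually-periodic : ∀ (f : Fin n → Fin n) u → ∃₂ λ a q → iter f (suc q) (iter f a u) ≡ iter f a u
  eventually-periodic f u with FinP.pigeonhole (ℕP.n<1+n n) (λ (i : Fin (suc n)) → iter f (toℕ i) u)
  ... | i , j , i<j , fⁱ≡fʲ = toℕ i , q , periodic
    where
    q = toℕ j ℕ.∸ suc (toℕ i)
    periodic : iter f (suc q) (iter f (toℕ i) u) ≡ iter f (toℕ i) u
    periodic = begin
      iter f (suc q) (iter f (toℕ i) u) ≡⟨ sym (iter-+ f (suc q) (toℕ i) u) ⟩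
      iter f (suc q ℕ.+ toℕ i) u        ≡⟨ cong (λ k → iter f k u) (trans (sym (ℕP.+-suc q (toℕ i))) (ℕP.m∸n+n≡m i<j)) ⟩
      iter f (toℕ j) u                  ≡⟨ sym fⁱ≡fʲ ⟩
      iter f (toℕ i) u                  ∎
      where open ≡-Reasoning

  module PeriodicOrbit (ϱ : RotorVec G) (x : Fin n) (q : ℕ) (periodic : iter (rstep G ϱ) (suc q) x ≡ x) where
    f : Fin n → Fin n
    f = rstep G ϱ

    Reached : Fin n → Set
    Reached y = ∃[ k ] iter f (toℕ {suc q} k) x ≡ y

    reached? : ∀ y → Dec (Reached y)
    reached? y = FinP.any? (λ k → iter f (toℕ k) x ≟ y)

    orbit : Subset n
    orbit = subsetOf reached?

    in-orbit : ∀ {y} → Reached y → y ∈ₛ orbit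
    in-orbit = ∈-subsetOf⁺ reached?

    from-orbit : ∀ {y} → y ∈ₛ orbit → Reached y
    from-orbit = ∈-subsetOf⁻ reached?

    iterate-in-orbit : ∀ k → Reached (iter f k x)
    iterate-in-orbit zero = Fin.zero , refl
    iterate-in-orbit (suc k) with iterate-in-orbit k
    ... | j , fʲx≡fᵏx with suc (toℕ j) ℕ.<? suc q
    ...   | yes lt = fromℕ< lt , trans (cong (λ t → iter f t x) (FinP.toℕ-fromℕ< lt)) (cong f fʲx≡fᵏx)
    ...   | no ¬lt = Fin.zero , trans (sym periodic) (trans (cong (λ t → iter f t x) wraps) (cong f fʲx≡fᵏx))
      where
      wraps : suc q ≡ suc (toℕ j)
      wraps = ℕP.≤-antisym (ℕP.≮⇒≥ ¬lt) (FinP.toℕ<n j)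

    back-to-start : ∀ (a : Fin (suc q)) → iter f (suc q ℕ.∸ toℕ a) (iter f (toℕ a) x) ≡ x
    back-to-start a = begin
      iter f (suc q ℕ.∸ toℕ a) (iter f (toℕ a) x) ≡⟨ sym (iter-+ f (suc q ℕ.∸ toℕ a) (toℕ a) x) ⟩
      iter f (suc q ℕ.∸ toℕ a ℕ.+ toℕ a) x        ≡⟨ cong (λ t → iter f t x) (ℕP.m∸n+n≡m (ℕP.<⇒≤ (FinP.toℕ<n a))) ⟩
      iter f (suc q) x                            ≡⟨ periodic ⟩
      x                                           ∎
      where open ≡-Reasoning

    orbit-is-cycle : IsRotorCycle G ϱ orbit
    orbit-is-cycle = (x , in-orbit (Fin.zero , refl)) , closed , connected
      where
      closed : ∀ u → u ∈ₛ orbit → f u ∈ₛ orbit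
      closed u u∈ with from-orbit u∈
      ... | k , refl = in-orbit (iterate-in-orbit (suc (toℕ k)))
      connected : ∀ u w → u ∈ₛ orbit → w ∈ₛ orbit → ∃[ k ] iter f k u ≡ w
      connected u w u∈ w∈ with from-orbit u∈ | from-orbit w∈
      ... | a , refl | b , refl =
        toℕ b ℕ.+ (suc q ℕ.∸ toℕ a) ,
        trans (iter-+ f (toℕ b) (suc q ℕ.∸ toℕ a) _) (cong (iter f (toℕ b)) (back-to-start a))

  cycle-inside : ∀ ϱ (P : Fin n → Set) u → P u → (∀ y → P y → P (rstep G ϱ y)) →
    ∃[ S ] (IsRotorCycle G ϱ S × (∀ y → y ∈ₛ S → P y))
  cycle-inside ϱ P u Pu closed with eventually-periodic (rstep G ϱ) u
  ... | a , q , periodic = orbit , orbit-is-cycle , inside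
    where
    open PeriodicOrbit ϱ (iter (rstep G ϱ) a u) q periodic
    iterates : ∀ k → P (iter f k u)
    iterates zero    = Pu
    iterates (suc k) = closed _ (iterates k)
    inside : ∀ y → y ∈ₛ orbit → P y
    inside y y∈ with from-orbit y∈
    ... | k , refl = subst P (iter-+ f (toℕ k) a u) (iterates (toℕ k ℕ.+ a))

  -- A non-empty rotor-closed set of vertices contains the chip vertex of a unicycle,
  -- since it contains a rotor cycle and the unicycle has only one, through v.
  unicycle-vertex-inside : ∀ {v ϱ} → Unicycle G v ϱ → (P : Fin n → Set) → ∀ u → P u →
    (∀ y → P y → P (rstep G ϱ y)) → P v
  unicycle-vertex-inside {ϱ = ϱ} (_ , S , _ , v∈S , unique) P u Pu closed
    with cycle-inside ϱ P u Pu closed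
  ... | S' , S'-cycle , S'⊆P = S'⊆P _ (subst (_ ∈ₛ_) (sym (unique S' S'-cycle)) v∈S)

  source-is-routed : ∀ {v ϱ'} → Unicycle G v ϱ' → ∀ s w ϱ u → u ∈ s →
    run s (𝟙 G w , ϱ) ≡ (𝟙 G v , ϱ') → w ∈ s
  source-is-routed {v} {ϱ'} unicycle s w ϱ u u∈s reach with w ∈? s
  ... | yes w∈s = w∈s
  ... | no  w∉s = ⊥-elim (w∉s (subst (_∈ s) (sym w≡v) v∈s))
    where
    c : DRC G
    c = 𝟙 G w , ϱ
    final : ∀ z → chips (run s c) z ≡ δ v (+ 1) z
    final z = trans (cong (λ c' → chips c' z) reach) (𝟙-lookup v z)
    -- the chip at w is never lost, and at the end only v holds a chip
    w≡v : w ≡ v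
    w≡v = δ-support v (+ 1) w (subst (+ 0 <_) (final w) (ℤP.<-≤-trans (𝟙-positive w) (unrouted-≤ s c w w∉s)))
    -- as w = v, every vertex starts and ends with the same number of chips,
    -- so no vertex outside s can have received one
    received-in-s : ∀ z → Receives s c z → z ∈ s
    received-in-s z received with z ∈? s
    ... | yes z∈s = z∈s
    ... | no  z∉s = ⊥-elim (ℤP.<-irrefl refl (subst₂ _<_ unchanged (final z) (unrouted-< s c z z∉s received)))
      where
      unchanged : chips c z ≡ δ v (+ 1) z
      unchanged = trans (𝟙-lookup w z) (cong (λ a → δ a (+ 1) z) w≡v)
    closed : ∀ y → y ∈ s → rstep G ϱ' y ∈ s
    closed y y∈s = received-in-s _
      (subst (λ c' → Receives s c (head (lookup (proj₂ c') y))) reach (routed-rotor-receives s c y y∈s))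
    v∈s : v ∈ s
    v∈s = unicycle-vertex-inside {ϱ = ϱ'} unicycle (_∈ s) u u∈s closed

  legalise : ∀ {v ϱ'} → Unicycle G v ϱ' → ∀ k s → length s ≡ k → ∀ w ϱ →
    run s (𝟙 G w , ϱ) ≡ (𝟙 G v , ϱ') → InOrbit G (𝟙 G w , ϱ) (𝟙 G v , ϱ')
  legalise unicycle zero    []        _   w ϱ reach = subst (InOrbit G (𝟙 G w , ϱ)) reach ε
  legalise unicycle (suc k) []        ()
  legalise unicycle zero    (_ ∷ _)   ()
  legalise {v} {ϱ'} unicycle (suc k) s@(u ∷ _) len w ϱ reach =
    (w , 𝟙-positive w , refl)
      ◅ subst (λ c → InOrbit G c (𝟙 G v , ϱ')) (sym (route-𝟙 w ϱ))
              (legalise unicycle k (s ─ w∈s) shorter (dest ϱ w) _ rest-reaches)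
    where
    w∈s : w ∈ s
    w∈s = source-is-routed unicycle s w ϱ u (here refl) reach
    shorter : length (s ─ w∈s) ≡ k
    shorter = ℕP.suc-injective (trans (sym (length-removeAt′ s (index w∈s))) len)
    rest-reaches : run (s ─ w∈s) (𝟙 G (dest ϱ w) , ϱ [ w ]≔ next (lookup ϱ w)) ≡ (𝟙 G v , ϱ')
    rest-reaches = trans (cong (run (s ─ w∈s)) (sym (route-𝟙 w ϱ))) (trans (sym (run-─ s w∈s _)) reach)

  legal⇒steps : ∀ {c c'} → InOrbit G c c' → _∼_ G c c'
  legal⇒steps = Star.map (λ { (v , _ , routed) → v , routed })

corollary3p9 : (G : RibbonDigraph) → StronglyConnected G →
    (v₁ v₂ : Fin (RibbonDigraph.n G)) (ϱ₁ ϱ₂ : RotorVec G) →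
    Unicycle G v₁ ϱ₁ → Unicycle G v₂ ϱ₂ →
    (InOrbit G (𝟙 G v₁ , ϱ₁) (𝟙 G v₂ , ϱ₂) ⇔ _∼_ G (𝟙 G v₁ , ϱ₁) (𝟙 G v₂ , ϱ₂))
corollary3p9 G _ v₁ v₂ ϱ₁ ϱ₂ _ unicycle₂ = mk⇔ legal⇒steps steps⇒legal
  where
  open Rotor G
  steps⇒legal : _∼_ G (𝟙 G v₁ , ϱ₁) (𝟙 G v₂ , ϱ₂) → InOrbit G (𝟙 G v₁ , ϱ₁) (𝟙 G v₂ , ϱ₂)
  steps⇒legal steps with steps⇒run steps
  ... | s , reach = legalise unicycle₂ (length s) s refl v₁ ϱ₁ reach
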